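{- Let $m \geq 2$, $B \in SL_{2}(\mathbb{Z}/2^{m}\mathbb{Z})$ and $n \geq 3$. Let $\Omega_{k}^{C}(m):=\{(a_{1},\ldots,a_{k}) \in (\mathbb{Z}/2^{m}\mathbb{Z})^{k}:~M_{k}(a_{1},\ldots,a_{k})=C\}$ for $C\in SL_2(\mathbb{Z}/2^m\mathbb{Z})$, and $\Lambda_{n}^{B}(m,-1):=\{(a_{1},\ldots,a_{n}) \in \Omega_{n}^{B}(m):~a_{2}=-1\}$. Then \[\left|\Lambda_{n}^{B}(m,-1)\right|=\left|\Omega_{n-1}^{ -B}(m)\right|.\]
   Context: For $a_1,\ldots,a_k$ in a commutative unitary ring, $M_{k}(a_1,\ldots,a_k):=\begin{pmatrix} a_{k} & -1 \\ 1 & 0\end{pmatrix}\cdots\begin{pmatrix} a_{1} & -1 \\ 1 & 0\end{pmatrix}$. -}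

module Defs where

open import Data.Nat using (ℕ; zero; suc; _^_; NonZero) renaming (_+_ to _+ℕ_; _*_ to _*ℕ_; _∸_ to _∸ℕ_)
open import Data.Nat.Properties using (m^n≢0)
open import Data.Nat.DivMod using (_mod_)
open import Data.Fin using (Fin; toℕ) renaming (_≟_ to _≟F_)
open import Data.Vec using (Vec; []; _∷_)
open import Data.List using (List; []; _∷_; length; filter; concatMap; map)
open import Data.List using () renaming (allFin to allFinL)
open import Data.Product using (_×_; _,_)
open import Data.Empty using (⊥)
open import Relation.Nullary using (Dec; yes; no)
open import Relation.Nullary.Decidable using (_×-dec_; map′)
open import Relation.Unary using (Pred; Decidable)
open import Relation.Binary.PropositionalEquality using (_≡_; refl; cong)
open import Level using (0ℓ)

Zmod : ℕ → Set
Zmod m = Fin (2 ^ m)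


module Ring (m : ℕ) where
  instance
    nz2^ : NonZero (2 ^ m)
    nz2^ = m^n≢0 2 m

  infixl 6 _+_ _-_
  infixl 7 _*_

  _+_ : Zmod m → Zmod m → Zmod m
  a + b = (toℕ a +ℕ toℕ b) mod (2 ^ m)

  _*_ : Zmod m → Zmod m → Zmod m
  a * b = (toℕ a *ℕ toℕ b) mod (2 ^ m)

  -_ : Zmod m → Zmod m
  - a = (2 ^ m ∸ℕ toℕ a) mod (2 ^ m)

  _-_ : Zmod m → Zmod m → Zmod m
  a - b = a + (- b)

  0# 1# : Zmod m
  0# = 0 mod (2 ^ m)
  1# = 1 mod (2 ^ m)

record Mat (m : ℕ) : Set where
  constructor mat
  field
    a b c d : Zmod m

module _ (m : ℕ) where
  open Ring m
  infixl 7 _·_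

  _·_ : Mat m → Mat m → Mat m
  mat a b c d · mat a' b' c' d' =
    mat (a * a' + b * c') (a * b' + b * d') (c * a' + d * c') (c * b' + d * d')

  I₂ : Mat m
  I₂ = mat 1# 0# 0# 1#

  negMat : Mat m → Mat m
  negMat (mat a b c d) = mat (- a) (- b) (- c) (- d)

  det : Mat m → Zmod m
  det (mat a b c d) = a * d - b * c

  InSL₂ : Mat m → Set
  InSL₂ B = det B ≡ 1#

  E : Zmod m → Mat m
  E x = mat x (- 1#) 1# 0#

  -- M_k(a₁,…,a_k) = E(a_k) ⋯ E(a₁); the vector is listed as a₁ ∷ a₂ ∷ … ∷ a_k
  M : {k : ℕ} → Vec (Zmod m) k → Mat m
  M [] = I₂
  M (x ∷ xs) = M xs · E x

  _≟M_ : (A B : Mat m) → Dec (A ≡ B)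
  mat a b c d ≟M mat a' b' c' d' =
    map′ (λ { (refl , refl , refl , refl) → refl })
         (λ { refl → refl , refl , refl , refl })
         ((a ≟F a') ×-dec (b ≟F b') ×-dec (c ≟F c') ×-dec (d ≟F d'))

  allVecs : (k : ℕ) → List (Vec (Zmod m) k)
  allVecs zero = [] ∷ []
  allVecs (suc k) = concatMap (λ x → map (x ∷_) (allVecs k)) (allFinL (2 ^ m))

  count : (k : ℕ) {P : Pred (Vec (Zmod m) k) 0ℓ} → Decidable P → ℕ
  count k P? = length (filter P? (allVecs k))

  SecondIs : Zmod m → {k : ℕ} → Vec (Zmod m) k → Set
  SecondIs x (_ ∷ y ∷ _) = y ≡ x
  SecondIs x _ = ⊥

  secondIs? : (x : Zmod m) {k : ℕ} → (v : Vec (Zmod m) k) → Dec (SecondIs x v)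
  secondIs? x [] = no (λ ())
  secondIs? x (_ ∷ []) = no (λ ())
  secondIs? x (_ ∷ y ∷ _) = y ≟F x

open Ring public

cardΩ : (m k : ℕ) → Mat m → ℕ
cardΩ m k C = count m k (λ v → _≟M_ m (M m v) C)

cardΛ : (m n : ℕ) → Mat m → ℕ
cardΛ m n B = count m n (λ v → (_≟M_ m (M m v) B) ×-dec secondIs? m (-_ m (1# m)) v)

{-# OPTIONS --safe #-}
module Submission where

-- The whole count rests on the identity E(b) E(-1) E(a) = -E(b+1) E(a+1), valid in every
-- commutative ring: hence M(a₁,-1,a₃,…,aₙ) = B exactly when M(a₁+1,a₃+1,…,aₙ) = -B, so
-- deleting the entry -1 and shifting the two neighbouring entries by 1 is a bijection from
-- Λₙᴮ(m,-1) onto Ωₙ₋₁⁻ᴮ(m).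

open import Data.Nat using (ℕ; zero; suc; _∸_; _^_; _%_; _≤_; s≤s)
  renaming (_+_ to _+ℕ_; _*_ to _*ℕ_)
import Data.Nat.Properties as ℕ
open import Data.Nat.DivMod using (_mod_; %-distribˡ-+; %-distribˡ-*; m<n⇒m%n≡m; [m+n]%n≡m%n)
open import Data.Fin using (Fin; toℕ; punchIn)
open import Data.Fin.Properties using (toℕ-fromℕ<; toℕ-injective; toℕ<n; punchInᵢ≢i)
open import Data.Fin.Permutation using (Permutation′; permutation)
open import Data.Vec using (Vec; _∷_)
open import Data.List using (List; []; _∷_; _++_; length; filter; concat; map; tabulate; allFin)
open import Data.List.Properties using (filter-++; length-++; filter-≐; filter-none; map-tabulate)
open import Data.List.Relation.Unary.All using (universal)
open import Data.Product using (_×_; _,_; proj₁; proj₂)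
open import Function using (_∘_; id; _⇔_; mk⇔; Equivalence)
open import Level using (0ℓ)
open import Relation.Nullary using (¬_; yes; no)
open import Relation.Nullary.Decidable using (_×-dec_)
open import Relation.Unary using (Pred; Decidable; _≐_)
open import Relation.Binary.PropositionalEquality
  using (_≡_; _≢_; refl; sym; trans; cong; cong₂; module ≡-Reasoning)
open import Relation.Binary.PropositionalEquality.Properties using (isEquivalence)
open import Algebra.Bundles using (CommutativeRing)
open import Algebra.Structures using (IsCommutativeRing)
open import Algebra.Consequences.Propositional using (comm∧idˡ⇒id; comm∧invˡ⇒inv; comm∧distrʳ⇒distr)
open import Algebra.Properties.CommutativeMonoid.Sum ℕ.+-0-commutativeMonoid
  using (sum; sum-syntax; sum-cong-≗; sum-remove; sum-replicate-zero; sum-permute)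
import Algebra.Properties.Ring as RingProperties

open import Defs
  using (Zmod; module Ring; Mat; mat; _·_; E; negMat; M; InSL₂; count; allVecs; cardΛ; cardΩ;
         _≟M_; SecondIs; secondIs?)

module _ {A : Set} {P : Pred A 0ℓ} (P? : Decidable P) where

  length-filter-++ : ∀ xs ys →
    length (filter P? (xs ++ ys)) ≡ length (filter P? xs) +ℕ length (filter P? ys)
  length-filter-++ xs ys = trans (cong length (filter-++ P? xs ys)) (length-++ (filter P? xs))

  length-filter-concat-tabulate : ∀ {n} (f : Fin n → List A) →
    length (filter P? (concat (tabulate f))) ≡ ∑[ i < n ] length (filter P? (f i))
  length-filter-concat-tabulate {zero}  f = refl
  length-filter-concat-tabulate {suc n} f =
    trans (length-filter-++ (f Fin.zero) _)
          (cong (length (filter P? (f Fin.zero)) +ℕ_) (length-filter-concat-tabulate (f ∘ Fin.suc)))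

length-filter-map : ∀ {A B : Set} {P : Pred A 0ℓ} (P? : Decidable P) (g : B → A) xs →
  length (filter P? (map g xs)) ≡ length (filter (P? ∘ g) xs)
length-filter-map P? g []       = refl
length-filter-map P? g (x ∷ xs) with P? (g x)
... | yes _ = cong suc (length-filter-map P? g xs)
... | no  _ = length-filter-map P? g xs

sum-single : ∀ {n} (f : Fin n → ℕ) i → (∀ j → j ≢ i → f j ≡ 0) → sum f ≡ f i
sum-single {suc n} f i off-i = begin
  sum f                               ≡⟨ sum-remove f ⟩
  f i +ℕ ∑[ j < n ] f (punchIn i j)  ≡⟨ cong (f i +ℕ_) (sum-cong-≗ (λ j → off-i _ (punchInᵢ≢i i j))) ⟩
  f i +ℕ ∑[ j < n ] 0                ≡⟨ cong (f i +ℕ_) (sum-replicate-zero n) ⟩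
  f i +ℕ 0                           ≡⟨ ℕ.+-identityʳ (f i) ⟩
  f i                                 ∎
  where open ≡-Reasoning

-- Every operation of ℤ/2^mℤ is [_] applied to the corresponding operation on representatives,
-- and [_] is a homomorphism from ℕ, so each ring law is transported from ℕ.
module ZmodRing (m : ℕ) where
  open Ring m
  open ≡-Reasoning
  open import Algebra.Definitions {A = Zmod m} _≡_

  private
    N : ℕ
    N = 2 ^ m

  [_] : ℕ → Zmod m
  [ x ] = x mod N

  toℕ-[] : ∀ x → toℕ [ x ] ≡ x % N
  toℕ-[] x = toℕ-fromℕ< _

  []-toℕ : ∀ a → [ toℕ a ] ≡ a
  []-toℕ a = toℕ-injective (trans (toℕ-[] (toℕ a)) (m<n⇒m%n≡m (toℕ<n a)))

  %≡%⇒[]≡[] : ∀ {x y} → x % N ≡ y % N → [ x ] ≡ [ y ]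
  %≡%⇒[]≡[] {x} {y} e = toℕ-injective (trans (toℕ-[] x) (trans e (sym (toℕ-[] y))))

  []-homo-+ : ∀ x y → [ x ] + [ y ] ≡ [ x +ℕ y ]
  []-homo-+ x y = %≡%⇒[]≡[] (begin
    (toℕ [ x ] +ℕ toℕ [ y ]) % N ≡⟨ cong₂ (λ s t → (s +ℕ t) % N) (toℕ-[] x) (toℕ-[] y) ⟩
    (x % N +ℕ y % N) % N         ≡⟨ %-distribˡ-+ x y N ⟨
    (x +ℕ y) % N                 ∎)

  []-homo-* : ∀ x y → [ x ] * [ y ] ≡ [ x *ℕ y ]
  []-homo-* x y = %≡%⇒[]≡[] (begin
    (toℕ [ x ] *ℕ toℕ [ y ]) % N ≡⟨ cong₂ (λ s t → (s *ℕ t) % N) (toℕ-[] x) (toℕ-[] y) ⟩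
    (x % N *ℕ (y % N)) % N       ≡⟨ %-distribˡ-* x y N ⟨
    (x *ℕ y) % N                 ∎)

  +-assoc : Associative _+_
  +-assoc a b c = begin
    (a + b) + c                          ≡⟨ cong ((a + b) +_) ([]-toℕ c) ⟨
    [ toℕ a +ℕ toℕ b ] + [ toℕ c ]       ≡⟨ []-homo-+ _ _ ⟩
    [ toℕ a +ℕ toℕ b +ℕ toℕ c ]          ≡⟨ cong [_] (ℕ.+-assoc (toℕ a) _ _) ⟩
    [ toℕ a +ℕ (toℕ b +ℕ toℕ c) ]        ≡⟨ []-homo-+ _ _ ⟨
    [ toℕ a ] + (b + c)                  ≡⟨ cong (_+ (b + c)) ([]-toℕ a) ⟩
    a + (b + c)                          ∎

  *-assoc : Associative _*_
  *-assoc a b c = begin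
    (a * b) * c                          ≡⟨ cong ((a * b) *_) ([]-toℕ c) ⟨
    [ toℕ a *ℕ toℕ b ] * [ toℕ c ]       ≡⟨ []-homo-* _ _ ⟩
    [ toℕ a *ℕ toℕ b *ℕ toℕ c ]          ≡⟨ cong [_] (ℕ.*-assoc (toℕ a) _ _) ⟩
    [ toℕ a *ℕ (toℕ b *ℕ toℕ c) ]        ≡⟨ []-homo-* _ _ ⟨
    [ toℕ a ] * (b * c)                  ≡⟨ cong (_* (b * c)) ([]-toℕ a) ⟩
    a * (b * c)                          ∎

  *-distribʳ-+ : _*_ DistributesOverʳ _+_
  *-distribʳ-+ a b c = begin
    (b + c) * a                                  ≡⟨ cong ((b + c) *_) ([]-toℕ a) ⟨
    [ toℕ b +ℕ toℕ c ] * [ toℕ a ]               ≡⟨ []-homo-* _ _ ⟩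
    [ (toℕ b +ℕ toℕ c) *ℕ toℕ a ]                ≡⟨ cong [_] (ℕ.*-distribʳ-+ (toℕ a) (toℕ b) _) ⟩
    [ toℕ b *ℕ toℕ a +ℕ toℕ c *ℕ toℕ a ]         ≡⟨ []-homo-+ _ _ ⟨
    b * a + c * a                                ∎

  +-comm : Commutative _+_
  +-comm a b = cong [_] (ℕ.+-comm (toℕ a) (toℕ b))

  *-comm : Commutative _*_
  *-comm a b = cong [_] (ℕ.*-comm (toℕ a) (toℕ b))

  +-identityˡ : LeftIdentity 0# _+_
  +-identityˡ a = begin
    0# + a         ≡⟨ cong (0# +_) ([]-toℕ a) ⟨
    [ 0 ] + [ toℕ a ] ≡⟨ []-homo-+ 0 (toℕ a) ⟩
    [ toℕ a ]      ≡⟨ []-toℕ a ⟩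
    a              ∎

  *-identityˡ : LeftIdentity 1# _*_
  *-identityˡ a = begin
    1# * a            ≡⟨ cong (1# *_) ([]-toℕ a) ⟨
    [ 1 ] * [ toℕ a ] ≡⟨ []-homo-* 1 (toℕ a) ⟩
    [ 1 *ℕ toℕ a ]    ≡⟨ cong [_] (ℕ.*-identityˡ (toℕ a)) ⟩
    [ toℕ a ]         ≡⟨ []-toℕ a ⟩
    a                 ∎

  -‿inverseˡ : LeftInverse 0# -_ _+_
  -‿inverseˡ a = begin
    - a + a                     ≡⟨ cong (- a +_) ([]-toℕ a) ⟨
    [ N ∸ toℕ a ] + [ toℕ a ]   ≡⟨ []-homo-+ _ _ ⟩
    [ N ∸ toℕ a +ℕ toℕ a ]      ≡⟨ cong [_] (ℕ.m∸n+n≡m (ℕ.<⇒≤ (toℕ<n a))) ⟩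
    [ N ]                       ≡⟨ %≡%⇒[]≡[] ([m+n]%n≡m%n 0 N) ⟩
    0#                          ∎

  isCommutativeRing : IsCommutativeRing _≡_ _+_ _*_ -_ 0# 1#
  isCommutativeRing = record
    { isRing = record
      { +-isAbelianGroup = record
        { isGroup = record
          { isMonoid = record
            { isSemigroup = record
              { isMagma = record { isEquivalence = isEquivalence ; ∙-cong = cong₂ _+_ }
              ; assoc = +-assoc
              }
            ; identity = comm∧idˡ⇒id +-comm +-identityˡ
            }
          ; inverse = comm∧invˡ⇒inv +-comm -‿inverseˡ
          ; ⁻¹-cong = cong (-_)
          }
        ; comm = +-comm
        }
      ; *-cong = cong₂ _*_
      ; *-assoc = *-assoc
      ; *-identity = comm∧idˡ⇒id *-comm *-identityˡ
      ; distrib = comm∧distrʳ⇒distr (cong₂ _+_) *-comm *-distribʳ-+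
      }
    ; *-comm = *-comm
    }

  commutativeRing : CommutativeRing 0ℓ 0ℓ
  commutativeRing = record { isCommutativeRing = isCommutativeRing }

module Matrices (m : ℕ) where
  open CommutativeRing (ZmodRing.commutativeRing m) hiding (refl; sym; trans)
  open RingProperties ring
  open ≡-Reasoning

  infixl 7 _∙_
  _∙_ : Mat m → Mat m → Mat m
  _∙_ = _·_ m

  mat-cong : ∀ {a b c d a′ b′ c′ d′ : Carrier} → a ≡ a′ → b ≡ b′ → c ≡ c′ → d ≡ d′ →
             mat {m} a b c d ≡ mat a′ b′ c′ d′
  mat-cong refl refl refl refl = refl

  negMat-involutive : ∀ X → negMat m (negMat m X) ≡ X
  negMat-involutive (mat a b c d) =
    mat-cong (-‿involutive a) (-‿involutive b) (-‿involutive c) (-‿involutive d)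

  x*-1≡-x : ∀ x → x * - 1# ≡ - x
  x*-1≡-x x = trans (*-comm x (- 1#)) (-1*x≈-x x)

  mat·E : ∀ p q r s y → mat p q r s ∙ E m y ≡ mat (p * y + q) (- p) (r * y + s) (- r)
  mat·E p q r s y = mat-cong (topRow p q) (bottomRow p q) (topRow r s) (bottomRow r s)
    where
    topRow : ∀ p q → p * y + q * 1# ≡ p * y + q
    topRow p q = cong (p * y +_) (*-identityʳ q)
    bottomRow : ∀ p q → p * - 1# + q * 0# ≡ - p
    bottomRow p q = trans (cong₂ _+_ (x*-1≡-x p) (zeroʳ q)) (+-identityʳ (- p))

  p*[y+1]+q≡p*y+q+p : ∀ p q y → p * (y + 1#) + q ≡ (p * y + q) + p
  p*[y+1]+q≡p*y+q+p p q y = begin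
    p * (y + 1#) + q    ≡⟨ cong (_+ q) (trans (distribˡ p y 1#) (cong (p * y +_) (*-identityʳ p))) ⟩
    (p * y + p) + q     ≡⟨ +-assoc (p * y) p q ⟩
    p * y + (p + q)     ≡⟨ cong (p * y +_) (+-comm p q) ⟩
    p * y + (q + p)     ≡⟨ +-assoc (p * y) q p ⟨
    (p * y + q) + p     ∎

  row-collapse : ∀ p q x y → let u = p * y + q; v = p * (y + 1#) + q in
    ((u * - 1# + - p) * x + - u ≡ - (v * (x + 1#) + - p)) × (- (u * - 1# + - p) ≡ - - v)
  row-collapse p q x y = firstEntry , cong -_ u·[-1]-p≡-v
    where
    u v : Carrier
    u = p * y + q
    v = p * (y + 1#) + q
    u·[-1]-p≡-v : u * - 1# + - p ≡ - v
    u·[-1]-p≡-v = begin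
      u * - 1# + - p    ≡⟨ cong (_+ - p) (x*-1≡-x u) ⟩
      - u + - p         ≡⟨ -‿+-comm u p ⟩
      - (u + p)         ≡⟨ cong -_ (p*[y+1]+q≡p*y+q+p p q y) ⟨
      - v               ∎
    -p+v≡u : - p + v ≡ u
    -p+v≡u = begin
      - p + v           ≡⟨ cong (- p +_) (p*[y+1]+q≡p*y+q+p p q y) ⟩
      - p + (u + p)     ≡⟨ cong (- p +_) (+-comm u p) ⟩
      - p + (p + u)     ≡⟨ +-assoc (- p) p u ⟨
      (- p + p) + u     ≡⟨ cong (_+ u) (-‿inverseˡ p) ⟩
      0# + u            ≡⟨ +-identityˡ u ⟩
      u                 ∎
    firstEntry : (u * - 1# + - p) * x + - u ≡ - (v * (x + 1#) + - p)
    firstEntry = begin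
      (u * - 1# + - p) * x + - u   ≡⟨ cong (λ w → w * x + - u) u·[-1]-p≡-v ⟩
      - v * x + - u                ≡⟨ cong (_+ - u) (-‿distribˡ-* v x) ⟨
      - (v * x) + - u              ≡⟨ -‿+-comm (v * x) u ⟩
      - (v * x + u)                ≡⟨ cong (λ w → - (v * x + w)) -p+v≡u ⟨
      - (v * x + (- p + v))        ≡⟨ cong -_ (+-assoc (v * x) (- p) v) ⟨
      - ((v * x + - p) + v)        ≡⟨ cong -_ (p*[y+1]+q≡p*y+q+p v (- p) x) ⟨
      - (v * (x + 1#) + - p)       ∎

  ·E[y]·E[-1]·E[x]≡-·E[y+1]·E[x+1] : ∀ X x y →
    X ∙ E m y ∙ E m (- 1#) ∙ E m x ≡ negMat m (X ∙ E m (y + 1#) ∙ E m (x + 1#))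
  ·E[y]·E[-1]·E[x]≡-·E[y+1]·E[x+1] (mat p q r s) x y = begin
    mat p q r s ∙ E m y ∙ E m (- 1#) ∙ E m x
      ≡⟨ cong (λ Y → Y ∙ E m (- 1#) ∙ E m x) (mat·E p q r s y) ⟩
    mat u₁ (- p) u₂ (- r) ∙ E m (- 1#) ∙ E m x
      ≡⟨ cong (_∙ E m x) (mat·E u₁ (- p) u₂ (- r) (- 1#)) ⟩
    mat w₁ (- u₁) w₂ (- u₂) ∙ E m x
      ≡⟨ mat·E w₁ (- u₁) w₂ (- u₂) x ⟩
    mat (w₁ * x + - u₁) (- w₁) (w₂ * x + - u₂) (- w₂)
      ≡⟨ mat-cong (proj₁ (row-collapse p q x y)) (proj₂ (row-collapse p q x y))
                  (proj₁ (row-collapse r s x y)) (proj₂ (row-collapse r s x y)) ⟩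
    negMat m (mat (v₁ * (x + 1#) + - p) (- v₁) (v₂ * (x + 1#) + - r) (- v₂))
      ≡⟨ cong (negMat m) (mat·E v₁ (- p) v₂ (- r) (x + 1#)) ⟨
    negMat m (mat v₁ (- p) v₂ (- r) ∙ E m (x + 1#))
      ≡⟨ cong (λ Y → negMat m (Y ∙ E m (x + 1#))) (mat·E p q r s (y + 1#)) ⟨
    negMat m (mat p q r s ∙ E m (y + 1#) ∙ E m (x + 1#)) ∎
    where
    u₁ u₂ v₁ v₂ w₁ w₂ : Carrier
    u₁ = p * y + q
    u₂ = r * y + s
    v₁ = p * (y + 1#) + q
    v₂ = r * (y + 1#) + s
    w₁ = u₁ * - 1# + - p
    w₂ = u₂ * - 1# + - r

  X≡-Y⇒[X≡B⇔Y≡-B] : ∀ {X Y} B → X ≡ negMat m Y → (X ≡ B ⇔ Y ≡ negMat m B)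
  X≡-Y⇒[X≡B⇔Y≡-B] {X} {Y} B X≡-Y = mk⇔
    (λ X≡B → trans (sym (negMat-involutive Y)) (cong (negMat m) (trans (sym X≡-Y) X≡B)))
    (λ Y≡-B → trans X≡-Y (trans (cong (negMat m) Y≡-B) (negMat-involutive B)))

  M[a∷-1∷b∷v]≡-M[a+1∷b+1∷v] : ∀ {k} a b (v : Vec Carrier k) →
    M m (a ∷ - 1# ∷ b ∷ v) ≡ negMat m (M m (a + 1# ∷ b + 1# ∷ v))
  M[a∷-1∷b∷v]≡-M[a+1∷b+1∷v] a b v = ·E[y]·E[-1]·E[x]≡-·E[y+1]·E[x+1] (M m v) a b

module Counting (m : ℕ) where
  open CommutativeRing (ZmodRing.commutativeRing m) using (Carrier; _+_; -_; 1#; ring)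
  open RingProperties ring using (//-rightDividesˡ; //-rightDividesʳ)
  open Matrices m using (M[a∷-1∷b∷v]≡-M[a+1∷b+1∷v]; X≡-Y⇒[X≡B⇔Y≡-B])
  open ≡-Reasoning

  count-∷ : ∀ k {P : Pred (Vec Carrier (suc k)) 0ℓ} (P? : Decidable P) →
    count m (suc k) P? ≡ ∑[ x < 2 ^ m ] count m k (λ v → P? (x ∷ v))
  count-∷ k P? = begin
    length (filter P? (concat (map cons-allVecs (allFin (2 ^ m)))))
      ≡⟨ cong (length ∘ filter P? ∘ concat) (map-tabulate id cons-allVecs) ⟩
    length (filter P? (concat (tabulate cons-allVecs)))
      ≡⟨ length-filter-concat-tabulate P? cons-allVecs ⟩
    ∑[ x < 2 ^ m ] length (filter P? (map (x ∷_) (allVecs m k)))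
      ≡⟨ sum-cong-≗ (λ x → length-filter-map P? (x ∷_) (allVecs m k)) ⟩
    ∑[ x < 2 ^ m ] count m k (λ v → P? (x ∷ v)) ∎
    where
    cons-allVecs : Carrier → List (Vec Carrier (suc k))
    cons-allVecs x = map (x ∷_) (allVecs m k)

  count-≐ : ∀ k {P Q : Pred (Vec Carrier k) 0ℓ} (P? : Decidable P) (Q? : Decidable Q) →
    P ≐ Q → count m k P? ≡ count m k Q?
  count-≐ k P? Q? P≐Q = cong length (filter-≐ P? Q? P≐Q (allVecs m k))

  count-∅ : ∀ k {P : Pred (Vec Carrier k) 0ℓ} (P? : Decidable P) → (∀ v → ¬ P v) → count m k P? ≡ 0
  count-∅ k P? ¬P = cong length (filter-none P? (universal ¬P (allVecs m k)))

  count-head-forced : ∀ k c {P : Pred (Vec Carrier (suc k)) 0ℓ} (P? : Decidable P) →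
    (∀ {x v} → P (x ∷ v) → x ≡ c) → count m (suc k) P? ≡ count m k (λ v → P? (c ∷ v))
  count-head-forced k c P? forced = trans (count-∷ k P?)
    (sum-single _ c (λ x x≢c → count-∅ k _ (λ v → x≢c ∘ forced)))

  translation : Carrier → Permutation′ (2 ^ m)
  translation c = permutation (_+ c) (_+ - c) (//-rightDividesˡ c) (//-rightDividesʳ c)

  sum-translate : ∀ c (f : Carrier → ℕ) → ∑[ x < 2 ^ m ] f (x + c) ≡ sum f
  sum-translate c f = sym (sum-permute f (translation c))

  cardΛ≡cardΩ : ∀ B k → cardΛ m (3 +ℕ k) B ≡ cardΩ m (2 +ℕ k) (negMat m B)
  cardΛ≡cardΩ B k = begin
    cardΛ m (3 +ℕ k) B
      ≡⟨ count-∷ (2 +ℕ k) Λ? ⟩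
    ∑[ a < 2 ^ m ] count m (2 +ℕ k) (λ v → Λ? (a ∷ v))
      ≡⟨ sum-cong-≗ (λ a → count-head-forced (1 +ℕ k) (- 1#) (λ v → Λ? (a ∷ v)) proj₂) ⟩
    ∑[ a < 2 ^ m ] count m (1 +ℕ k) (λ v → Λ? (a ∷ - 1# ∷ v))
      ≡⟨ sum-cong-≗ (λ a → count-∷ k (λ v → Λ? (a ∷ - 1# ∷ v))) ⟩
    ∑[ a < 2 ^ m ] ∑[ b < 2 ^ m ] count m k (λ v → Λ? (a ∷ - 1# ∷ b ∷ v))
      ≡⟨ sum-cong-≗ (λ a → sum-cong-≗ (λ b →
           count-≐ k (λ v → Λ? (a ∷ - 1# ∷ b ∷ v)) (λ v → Ω? (a + 1# ∷ b + 1# ∷ v)) (collapse a b))) ⟩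
    ∑[ a < 2 ^ m ] ∑[ b < 2 ^ m ] count m k (λ v → Ω? (a + 1# ∷ b + 1# ∷ v))
      ≡⟨ sum-cong-≗ (λ a → sum-translate 1# (λ b → count m k (λ v → Ω? (a + 1# ∷ b ∷ v)))) ⟩
    ∑[ a < 2 ^ m ] ∑[ b < 2 ^ m ] count m k (λ v → Ω? (a + 1# ∷ b ∷ v))
      ≡⟨ sum-translate 1# (λ a → ∑[ b < 2 ^ m ] count m k (λ v → Ω? (a ∷ b ∷ v))) ⟩
    ∑[ a < 2 ^ m ] ∑[ b < 2 ^ m ] count m k (λ v → Ω? (a ∷ b ∷ v))
      ≡⟨ sum-cong-≗ (λ a → count-∷ k (λ v → Ω? (a ∷ v))) ⟨
    ∑[ a < 2 ^ m ] count m (1 +ℕ k) (λ v → Ω? (a ∷ v))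
      ≡⟨ count-∷ (1 +ℕ k) Ω? ⟨
    cardΩ m (2 +ℕ k) (negMat m B) ∎
    where
    Λ? : ∀ {n} → Decidable (λ (v : Vec Carrier n) → M m v ≡ B × SecondIs m (- 1#) v)
    Λ? v = _≟M_ m (M m v) B ×-dec secondIs? m (- 1#) v
    Ω? : ∀ {n} → Decidable (λ (v : Vec Carrier n) → M m v ≡ negMat m B)
    Ω? v = _≟M_ m (M m v) (negMat m B)
    collapse : ∀ a b → (λ (v : Vec Carrier k) → M m (a ∷ - 1# ∷ b ∷ v) ≡ B × - 1# ≡ - 1#)
                     ≐ (λ v → M m (a + 1# ∷ b + 1# ∷ v) ≡ negMat m B)
    collapse a b = (λ {v} (M≡B , _) → Equivalence.to (iff v) M≡B)
                 , (λ {v} M≡-B → Equivalence.from (iff v) M≡-B , refl)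
      where
      iff : ∀ v → (M m (a ∷ - 1# ∷ b ∷ v) ≡ B) ⇔ (M m (a + 1# ∷ b + 1# ∷ v) ≡ negMat m B)
      iff v = X≡-Y⇒[X≡B⇔Y≡-B] B (M[a∷-1∷b∷v]≡-M[a+1∷b+1∷v] a b v)


proposition2p6 : (m : ℕ) → 2 ≤ m → (B : Mat m) → InSL₂ m B → (n : ℕ) → 3 ≤ n →
    cardΛ m n B ≡ cardΩ m (n ∸ 1) (negMat m B)
proposition2p6 m _ B _ (suc (suc (suc k))) (s≤s (s≤s (s≤s _))) = Counting.cardΛ≡cardΩ m B k
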